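{- Let $f:\mathbb{N}\to\mathbb{N}$ be a multiplicative function such that $f(p^{k-1})\le f(p^k)$ for every prime $p$ and integer $k\ge1$. Then $f$ is convenient if and only if for every prime $p$ and every $f$-practical integer $m$ coprime to $p$, the inequality $f(p)\le S_f(m)+1$ implies $f(p^{k+1})\le S_f(mp^k)+1$ for every integer $k\ge 0$.
   Context: $\mathbb{N}$ denotes the positive integers. $S_f(n)=\sum_{d\mid n} f(d)$. A positive integer $n$ is $f$-practical if every positive integer $m\le S_f(n)$ can be written as $m=\sum_{d\in\mathcal{D}} f(d)$ for some set $\mathcal{D}$ of divisors of $n$. Write $n=p_1^{e_1}\cdots p_k^{e_k}$ with distinct primes indexed so that $f(p_1)\le\cdots\le f(p_k)$, and put $m_i=\prod_{j=1}^i p_j^{e_j}$ for $0\le i<k$ (so $m_0=1$); $n$ is weakly $f$-practical if $f(p_{i+1})\le S_f(m_i)+1$ for every $0\le i<k$. The function $f$ is convenient if every weakly $f$-practical number is $f$-practical. -}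

module Defs where

open import Data.Nat using (ℕ; zero; suc; _+_; _*_; _^_; _≤_; _<_)
open import Data.Nat.Divisibility using (_∣_; _∣?_)
open import Data.Nat.Coprimality using (Coprime)
open import Data.Nat.Primality using (Prime)
open import Data.List using (List; []; _∷_; map; filter; upTo)
open import Data.Nat.ListAction using (sum)
open import Data.List.Relation.Binary.Sublist.Propositional using (_⊆_)
open import Data.List.Relation.Unary.AllPairs using (AllPairs)
open import Data.List.Relation.Unary.All using (All)
open import Data.Unit using (⊤)
open import Data.Product using (_×_; _,_; Σ; ∃; proj₁; proj₂)
open import Relation.Binary.PropositionalEquality using (_≡_; _≢_)

-- Arithmetic functions ℕ → ℕ; only the values at positive integers matter.

Multiplicative : (ℕ → ℕ) → Set
Multiplicative f =
  f 1 ≡ 1 × (∀ a b → 1 ≤ a → 1 ≤ b → Coprime a b → f (a * b) ≡ f a * f b)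

divisors : ℕ → List ℕ
divisors n = filter (λ d → d ∣? n) (map suc (upTo n))

S : (ℕ → ℕ) → ℕ → ℕ
S f n = sum (map f (divisors n))

-- n (positive) is f-practical: every 1 ≤ m ≤ S_f(n) is Σ_{d∈D} f(d) for some
-- set D of divisors of n (a sublist of the duplicate-free divisor list).
Practical : (ℕ → ℕ) → ℕ → Set
Practical f n = 1 ≤ n × (∀ m → 1 ≤ m → m ≤ S f n →
  Σ (List ℕ) λ D → D ⊆ divisors n × sum (map f D) ≡ m)

-- Prime-power factorisations as lists of (prime, exponent) pairs.
ppProduct : List (ℕ × ℕ) → ℕ
ppProduct [] = 1
ppProduct ((p , e) ∷ rest) = p ^ e * ppProduct rest

-- Condition f(p_{i+1}) ≤ S_f(m_i) + 1, where the list is processed from the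
-- head: the accumulator m holds m_i = product of the prime powers seen so far.
WeakCond : (ℕ → ℕ) → ℕ → List (ℕ × ℕ) → Set
WeakCond f m [] = ⊤
WeakCond f m ((p , e) ∷ rest) = (f p ≤ S f m + 1) × WeakCond f (m * p ^ e) rest

WeaklyPractical : (ℕ → ℕ) → ℕ → Set
WeaklyPractical f n = Σ (List (ℕ × ℕ)) λ fac →
    All (λ pe → Prime (proj₁ pe) × 1 ≤ proj₂ pe) fac
  × AllPairs (λ a b → proj₁ a ≢ proj₁ b) fac
  × AllPairs (λ a b → f (proj₁ a) ≤ f (proj₁ b)) fac
  × ppProduct fac ≡ n
  × WeakCond f 1 fac

Convenient : (ℕ → ℕ) → Set
Convenient f = ∀ n → WeaklyPractical f n → Practical f n

-- Backward: a weakly f-practical n = p₁^e₁ ⋯ p_k^e_k is reached from 1 one prime at a time, and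
-- f-practicality survives each step m p^j ↦ m p^(j+1) as soon as f(p^(j+1)) ≤ S_f(m p^j) + 1
-- (Stewart's argument); the hypothesis turns f(p_{i+1}) ≤ S_f(m_i) + 1 into exactly these bounds.
-- Forward: if n is f-practical and a is a proper divisor of n, representing S_f(a) + 1 needs a
-- divisor of n not dividing a, so S_f(a) + 1 is at least the least value of f on such divisors.
-- Along a factorisation of m sorted by f(p) this shows that m is weakly f-practical, hence so is
-- m p^(k+1), which is therefore f-practical by convenience; for a = m p^k the divisors outside a
-- are the p^(k+1) u with u ∣ m, whose f-values are at least f(p^(k+1)).

{-# OPTIONS --safe #-}
module Submission where

open import Defs
open import Data.Nat using (ℕ; zero; suc; _+_; _*_; _^_; _≤_; _<_; _∸_; z≤n; s≤s; _≟_;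
  >-nonZero; nonTrivial⇒n>1)
import Data.Nat as ℕ
open import Data.Nat.Properties
open import Data.Nat.Divisibility
open import Data.Nat.Coprimality as Coprime using (Coprime; coprime-divisor; 1-coprimeTo)
open import Data.Nat.Primality using (Prime; prime⇒irreducible; prime⇒nonZero; prime⇒nonTrivial)
open import Data.Nat.Primality.Factorisation using (factorise)
open import Data.Nat.Induction using (<-rec)
open import Data.Nat.ListAction using (sum)
open import Data.Nat.ListAction.Properties using (sum-++; sum-↭)
open import Algebra.Properties.CommutativeSemigroup *-commutativeSemigroup using (x∙yz≈y∙xz)
open import Data.List using (List; []; _∷_; map; filter; upTo; _++_)
open import Data.List.Properties using (map-++)
open import Data.List.Membership.Propositional using (_∈_; find)
open import Data.List.Membership.Propositional.Properties
  using (∈-filter⁺; ∈-filter⁻; ∈-map⁺; ∈-map⁻; ∈-upTo⁺; ∈-++⁺ˡ; ∈-++⁺ʳ; ∈-++⁻)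
open import Data.List.Membership.Propositional.Properties.WithK using (unique∧set⇒bag)
open import Data.List.Relation.Binary.BagAndSetEquality using (∼bag⇒↭)
open import Data.List.Relation.Binary.Permutation.Propositional using (_↭_)
import Data.List.Relation.Binary.Permutation.Propositional.Properties as ↭
open import Data.List.Relation.Binary.Sublist.Propositional as Sublist using (_⊆_; []; _∷_; _∷ʳ_)
open import Data.List.Relation.Binary.Sublist.Propositional.Properties using (All-resp-⊆; filter-⊆)
open import Data.List.Relation.Binary.Subset.Propositional using () renaming (_⊆_ to _⊆ₛ_)
open import Data.List.Relation.Binary.Subset.Propositional.Properties using () renaming (⊆-refl to ⊆ₛ-refl)
open import Data.List.Relation.Unary.All as All using (All; []; _∷_)
open import Data.List.Relation.Unary.All.Properties using (¬All⇒Any¬)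
open import Data.List.Relation.Unary.AllPairs using (AllPairs; []; _∷_)
open import Data.List.Relation.Unary.Any using (Any; here; there)
open import Data.List.Relation.Unary.Unique.Propositional using (Unique)
import Data.List.Relation.Unary.Unique.Propositional.Properties as Unique
open import Data.Product using (_×_; _,_; ∃; ∃₂; proj₁; proj₂)
open import Data.Sum using (inj₁; inj₂)
open import Data.Unit using (tt)
open import Data.Empty using (⊥-elim)
open import Function using (_∘_; _⇔_; mk⇔)
open import Relation.Binary using (DecidableEquality; Tri; tri<; tri≈; tri>)
open import Relation.Binary.PropositionalEquality
open import Relation.Nullary using (¬_; yes; no)

module _ {A : Set} (g : A → ℕ) where

  sum-map-++ : ∀ xs ys → sum (map g (xs ++ ys)) ≡ sum (map g xs) + sum (map g ys)
  sum-map-++ xs ys = trans (cong sum (map-++ g xs ys)) (sum-++ (map g xs) (map g ys))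

  sum-map-↭ : ∀ {xs ys} → xs ↭ ys → sum (map g xs) ≡ sum (map g ys)
  sum-map-↭ xs↭ys = sum-↭ (↭.map⁺ g xs↭ys)

  sum-map-mono-⊆ : ∀ {xs ys} → xs ⊆ ys → sum (map g xs) ≤ sum (map g ys)
  sum-map-mono-⊆ [] = ≤-refl
  sum-map-mono-⊆ (y ∷ʳ τ) = ≤-trans (sum-map-mono-⊆ τ) (m≤n+m _ (g y))
  sum-map-mono-⊆ (refl ∷ τ) = +-monoʳ-≤ (g _) (sum-map-mono-⊆ τ)

  ∈⇒≤-sum-map : ∀ {x xs} → x ∈ xs → g x ≤ sum (map g xs)
  ∈⇒≤-sum-map {xs = y ∷ _} (here refl) = m≤m+n (g y) _
  ∈⇒≤-sum-map {xs = y ∷ _} (there x∈xs) = ≤-trans (∈⇒≤-sum-map x∈xs) (m≤n+m _ (g y))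

Unique-resp-⊆ : ∀ {A : Set} {xs ys : List A} → xs ⊆ ys → Unique ys → Unique xs
Unique-resp-⊆ [] [] = []
Unique-resp-⊆ (_ ∷ʳ τ) (_ ∷ ys!) = Unique-resp-⊆ τ ys!
Unique-resp-⊆ (refl ∷ τ) (y∉ys ∷ ys!) = All-resp-⊆ τ y∉ys ∷ Unique-resp-⊆ τ ys!

sublist⇒subset : ∀ {A : Set} {xs ys : List A} → xs ⊆ ys → xs ⊆ₛ ys
sublist⇒subset τ = Sublist.lookup τ

module _ {A : Set} (_≟ᴬ_ : DecidableEquality A) where

  open import Data.List.Membership.DecPropositional _≟ᴬ_ using (_∈?_)

  filter-∈-↭ : ∀ {xs ys} → Unique xs → Unique ys → xs ⊆ₛ ys → filter (_∈? xs) ys ↭ xs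
  filter-∈-↭ {xs} {ys} xs! ys! xs⊆ys = ∼bag⇒↭ (unique∧set⇒bag (Unique.filter⁺ (_∈? xs) ys!) xs!
    (mk⇔ (proj₂ ∘ ∈-filter⁻ (_∈? xs) {xs = ys}) (λ x∈xs → ∈-filter⁺ (_∈? xs) (xs⊆ys x∈xs) x∈xs)))

  module _ (g : A → ℕ) {xs ys : List A} (xs! : Unique xs) (ys! : Unique ys) (xs⊆ys : xs ⊆ₛ ys) where

    sum-map-mono-⊆ₛ : sum (map g xs) ≤ sum (map g ys)
    sum-map-mono-⊆ₛ = subst (_≤ sum (map g ys)) (sum-map-↭ g (filter-∈-↭ xs! ys! xs⊆ys))
      (sum-map-mono-⊆ g (filter-⊆ (_∈? xs) ys))

    sublist-with-equal-sum : ∃ λ zs → zs ⊆ ys × sum (map g zs) ≡ sum (map g xs)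
    sublist-with-equal-sum =
      filter (_∈? xs) ys , filter-⊆ (_∈? xs) ys , sum-map-↭ g (filter-∈-↭ xs! ys! xs⊆ys)

∈-divisors⁺ : ∀ {d n} → 1 ≤ n → d ∣ n → d ∈ divisors n
∈-divisors⁺ {zero} n≥1 0∣n = ⊥-elim (<⇒≢ n≥1 (sym (0∣⇒≡0 0∣n)))
∈-divisors⁺ {suc d} {n} n≥1 d∣n =
  ∈-filter⁺ (_∣? n) (∈-map⁺ suc (∈-upTo⁺ (∣⇒≤ {{>-nonZero n≥1}} d∣n))) d∣n

∈-divisors⁻ : ∀ {d n} → d ∈ divisors n → 1 ≤ d × d ∣ n
∈-divisors⁻ {n = n} d∈ with ∈-filter⁻ (_∣? n) {xs = map suc (upTo n)} d∈
... | d∈suc , d∣n with ∈-map⁻ suc d∈suc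
... | _ , _ , refl = s≤s z≤n , d∣n

divisors-! : ∀ n → Unique (divisors n)
divisors-! n = Unique.filter⁺ (_∣? n) (Unique.map⁺ suc-injective (Unique.upTo⁺ n))

divisors-mono : ∀ {a b} → 1 ≤ b → a ∣ b → divisors a ⊆ₛ divisors b
divisors-mono b≥1 a∣b d∈ = ∈-divisors⁺ b≥1 (∣-trans (proj₂ (∈-divisors⁻ d∈)) a∣b)

module _ (f : ℕ → ℕ) where

  S-mono : ∀ {a b} → 1 ≤ b → a ∣ b → S f a ≤ S f b
  S-mono {a} {b} b≥1 a∣b = sum-map-mono-⊆ₛ _≟_ f (divisors-! a) (divisors-! b) (divisors-mono b≥1 a∣b)

  Representable : ℕ → ℕ → Set
  Representable n N = ∃ λ D → D ⊆ divisors n × sum (map f D) ≡ N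

  practical⇒representable : ∀ {n N} → Practical f n → N ≤ S f n → Representable n N
  practical⇒representable {n} {zero} _ _ = [] , Sublist.minimum (divisors n) , refl
  practical⇒representable {N = suc N} (_ , represent) N≤ = represent (suc N) (s≤s z≤n) N≤

  distinct-divisors⇒representable : ∀ {n D} → Unique D → D ⊆ₛ divisors n →
    Representable n (sum (map f D))
  distinct-divisors⇒representable {n} D! D⊆ = sublist-with-equal-sum _≟_ f D! (divisors-! n) D⊆

  practical-1 : f 1 ≡ 1 → Practical f 1
  practical-1 f1≡1 = s≤s z≤n , λ N N≥1 N≤ →
    1 ∷ [] , Sublist.⊆-refl , trans S1≡1 (≤-antisym N≥1 (subst (N ≤_) S1≡1 N≤))
    where
    S1≡1 : S f 1 ≡ 1
    S1≡1 = trans (+-identityʳ (f 1)) f1≡1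

-- Primes and p-adic splitting

*-pos⇒posʳ : ∀ m {n} → 1 ≤ m * n → 1 ≤ n
*-pos⇒posʳ m {zero} m*0≥1 = ⊥-elim (<⇒≱ m*0≥1 (≤-reflexive (*-zeroʳ m)))
*-pos⇒posʳ m {suc n} _ = s≤s z≤n

prime>1 : ∀ {p} → Prime p → 1 < p
prime>1 p-prime = nonTrivial⇒n>1 _ {{prime⇒nonTrivial p-prime}}

prime^≥1 : ∀ {p} → Prime p → ∀ k → 1 ≤ p ^ k
prime^≥1 {p} p-prime = m^n>0 p {{prime⇒nonZero p-prime}}

prime^>1 : ∀ {p k} → Prime p → 1 ≤ k → 1 < p ^ k
prime^>1 {p} p-prime = ^-monoʳ-< p (prime>1 p-prime)

^-monoʳ-∣ : ∀ p {a b} → a ≤ b → p ^ a ∣ p ^ b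
^-monoʳ-∣ p {a} {b} a≤b = divides (p ^ (b ∸ a)) (begin
  p ^ b               ≡⟨ cong (p ^_) (m+[n∸m]≡n a≤b) ⟨
  p ^ (a + (b ∸ a))   ≡⟨ ^-distribˡ-+-* p a (b ∸ a) ⟩
  p ^ a * p ^ (b ∸ a) ≡⟨ *-comm (p ^ a) _ ⟩
  p ^ (b ∸ a) * p ^ a ∎)
  where open ≡-Reasoning

prime∤⇒coprime : ∀ {p n} → Prime p → ¬ p ∣ n → Coprime p n
prime∤⇒coprime p-prime p∤n (d∣p , d∣n) with prime⇒irreducible p-prime d∣p
... | inj₁ d≡1 = d≡1
... | inj₂ refl = ⊥-elim (p∤n d∣n)

coprime⇒∤ : ∀ {p m} → Prime p → Coprime m p → ¬ p ∣ m
coprime⇒∤ p-prime m⊥p p∣m = <⇒≢ (prime>1 p-prime) (sym (m⊥p (p∣m , ∣-refl)))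

distinct-primes⇒coprime : ∀ {p q} → Prime p → Prime q → p ≢ q → Coprime p q
distinct-primes⇒coprime {p} p-prime q-prime p≢q = prime∤⇒coprime p-prime p∤q
  where
  p∤q : ¬ p ∣ _
  p∤q p∣q with prime⇒irreducible q-prime p∣q
  ... | inj₁ p≡1 = <⇒≢ (prime>1 p-prime) (sym p≡1)
  ... | inj₂ p≡q = p≢q p≡q

coprime-*ˡ : ∀ {a b c} → Coprime a c → Coprime b c → Coprime (a * b) c
coprime-*ˡ a⊥c b⊥c (d∣ab , d∣c) = b⊥c (coprime-divisor d⊥a d∣ab , d∣c)
  where
  d⊥a : Coprime _ _
  d⊥a (e∣d , e∣a) = a⊥c (e∣a , ∣-trans e∣d d∣c)

coprime-^ˡ : ∀ {a c} k → Coprime a c → Coprime (a ^ k) c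
coprime-^ˡ {c = c} zero _ = 1-coprimeTo c
coprime-^ˡ (suc k) a⊥c = coprime-*ˡ a⊥c (coprime-^ˡ k a⊥c)

p-adic-split : ∀ {p} → Prime p → ∀ d → 1 ≤ d → ∃₂ λ a u → d ≡ p ^ a * u × ¬ p ∣ u
p-adic-split {p} p-prime = <-rec _ split
  where
  split : ∀ d → (∀ {d′} → d′ < d → 1 ≤ d′ → ∃₂ λ a u → d′ ≡ p ^ a * u × ¬ p ∣ u) →
    1 ≤ d → ∃₂ λ a u → d ≡ p ^ a * u × ¬ p ∣ u
  split d rec d≥1 with p ∣? d
  ... | no p∤d = 0 , d , sym (+-identityʳ d) , p∤d
  ... | yes (divides q d≡q*p) with rec q<d q≥1
    where
    q≥1 : 1 ≤ q
    q≥1 = *-pos⇒posʳ p (subst (1 ≤_) (trans d≡q*p (*-comm q p)) d≥1)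
    q<d : q < d
    q<d = subst (q <_) (sym d≡q*p) (m<m*n q p {{>-nonZero q≥1}} (prime>1 p-prime))
  ... | a , u , q≡ , p∤u = suc a , u , d≡ , p∤u
    where
    open ≡-Reasoning
    d≡ : d ≡ p ^ suc a * u
    d≡ = begin
      d               ≡⟨ d≡q*p ⟩
      q * p           ≡⟨ cong (_* p) q≡ ⟩
      p ^ a * u * p   ≡⟨ *-comm (p ^ a * u) p ⟩
      p * (p ^ a * u) ≡⟨ *-assoc p (p ^ a) u ⟨
      p ^ suc a * u   ∎

p^[1+k]∤m*p^k : ∀ {p m} k → Prime p → ¬ p ∣ m → ¬ p ^ suc k ∣ m * p ^ k
p^[1+k]∤m*p^k {p} {m} k p-prime p∤m p^[1+k]∣ =
  p∤m (*-cancelˡ-∣ (p ^ k) {{>-nonZero (prime^≥1 p-prime k)}}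
    (subst₂ _∣_ (*-comm p (p ^ k)) (*-comm m (p ^ k)) p^[1+k]∣))

new-divisor : ∀ {p m d} k → Prime p → ¬ p ∣ m → 1 ≤ d → d ∣ m * p ^ suc k → ¬ d ∣ m * p ^ k →
  ∃ λ u → d ≡ p ^ suc k * u × u ∣ m
new-divisor {p} {m} k p-prime p∤m d≥1 d∣ d∤ with p-adic-split p-prime _ d≥1
... | a , u , refl , p∤u = by-exponent (<-cmp a (suc k))
  where
  u∣m : u ∣ m
  u∣m = coprime-divisor (Coprime.sym (coprime-^ˡ (suc k) (prime∤⇒coprime p-prime p∤u)))
    (subst (u ∣_) (*-comm m _) (∣-trans (n∣m*n (p ^ a)) d∣))
  by-exponent : Tri (a < suc k) (a ≡ suc k) (suc k < a) →
    ∃ λ v → p ^ a * u ≡ p ^ suc k * v × v ∣ m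
  by-exponent (tri< a<1+k _ _) = ⊥-elim (d∤ (subst (p ^ a * u ∣_) (*-comm (p ^ k) m)
    (*-pres-∣ (^-monoʳ-∣ p (≤-pred a<1+k)) u∣m)))
  by-exponent (tri≈ _ refl _) = u , refl , u∣m
  by-exponent (tri> _ _ 1+k<a) = ⊥-elim (p^[1+k]∤m*p^k (suc k) p-prime p∤m
    (∣-trans (∣-trans (^-monoʳ-∣ p 1+k<a) (m∣m*n u)) d∣))

module _ (f : ℕ → ℕ) (mult : Multiplicative f) where

  f-^* : ∀ {q u} a → Prime q → ¬ q ∣ u → 1 ≤ u → f (q ^ a * u) ≡ f (q ^ a) * f u
  f-^* a q-prime q∤u u≥1 =
    proj₂ mult _ _ (prime^≥1 q-prime a) u≥1 (coprime-^ˡ a (prime∤⇒coprime q-prime q∤u))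

  module _ (f-pos : ∀ n → 1 ≤ n → 1 ≤ f n) where

    f-^≤f-^* : ∀ {q u} a → Prime q → ¬ q ∣ u → 1 ≤ u → f (q ^ a) ≤ f (q ^ a * u)
    f-^≤f-^* a q-prime q∤u u≥1 = ≤-trans (m≤m*n _ (f _) {{>-nonZero (f-pos _ u≥1)}})
      (≤-reflexive (sym (f-^* a q-prime q∤u u≥1)))

    module _ (mono : ∀ p k → Prime p → 1 ≤ k → f (p ^ (k ∸ 1)) ≤ f (p ^ k)) where

      f-prime≤f-prime^ : ∀ {q} → Prime q → ∀ a → 1 ≤ a → f q ≤ f (q ^ a)
      f-prime≤f-prime^ {q} q-prime (suc zero) _ = ≤-reflexive (cong f (sym (*-identityʳ q)))
      f-prime≤f-prime^ {q} q-prime (suc (suc a)) _ =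
        ≤-trans (f-prime≤f-prime^ q-prime (suc a) (s≤s z≤n)) (mono q (suc (suc a)) q-prime (s≤s z≤n))

      f-prime≤f-multiple : ∀ {q d} → Prime q → q ∣ d → 1 ≤ d → f q ≤ f d
      f-prime≤f-multiple {q} q-prime q∣d d≥1 with p-adic-split q-prime _ d≥1
      ... | zero , u , refl , q∤u = ⊥-elim (q∤u (subst (q ∣_) (*-identityˡ u) q∣d))
      ... | suc a , u , refl , q∤u = ≤-trans (f-prime≤f-prime^ q-prime (suc a) (s≤s z≤n))
        (f-^≤f-^* (suc a) q-prime q∤u (*-pos⇒posʳ (q ^ suc a) d≥1))

-- Extending an f-practical number by a prime

bounded-decomposition : ∀ s {A F N} → F ≤ A + 1 → N ≤ A + F * s →
  ∃₂ λ t r → t ≤ s × r ≤ A × N ≡ r + F * t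
bounded-decomposition zero {A} {F} {N} _ N≤ = 0 , N , z≤n ,
  subst (N ≤_) (trans (cong (A +_) (*-zeroʳ F)) (+-identityʳ A)) N≤ ,
  sym (trans (cong (N +_) (*-zeroʳ F)) (+-identityʳ N))
bounded-decomposition (suc s) {A} {F} {N} F≤ N≤ with N ℕ.≤? A + F * s
... | yes N≤′ with bounded-decomposition s F≤ N≤′
...   | t , r , t≤s , r≤A , N≡ = t , r , m≤n⇒m≤1+n t≤s , r≤A , N≡
bounded-decomposition (suc s) {A} {F} {N} F≤ N≤ | no N≰ =
  suc s , N ∸ F * suc s , ≤-refl ,
  m≤n+o⇒m∸n≤o N (F * suc s) (subst (N ≤_) (+-comm A _) N≤) ,
  sym (m∸n+n≡m F[1+s]≤N)
  where
  open ≤-Reasoning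
  F[1+s]≤N : F * suc s ≤ N
  F[1+s]≤N = begin
    F * suc s       ≡⟨ *-suc F s ⟩
    F + F * s       ≤⟨ +-monoˡ-≤ (F * s) F≤ ⟩
    A + 1 + F * s   ≡⟨ cong (_+ F * s) (+-comm A 1) ⟩
    suc (A + F * s) ≤⟨ ≰⇒> N≰ ⟩
    N               ∎

module _ (f : ℕ → ℕ) (mult : Multiplicative f) {p m : ℕ}
  (p-prime : Prime p) (p∤m : ¬ p ∣ m) (m≥1 : 1 ≤ m) (j : ℕ) where

  private
    c = p ^ suc j
    c≥1 = prime^≥1 p-prime (suc j)
    m*p^j≥1 = *-mono-≤ m≥1 (prime^≥1 p-prime j)
    m*c≥1 = *-mono-≤ m≥1 c≥1

  divisors-m*p^[1+j] :
    divisors (m * p ^ suc j) ⊆ₛ divisors (m * p ^ j) ++ map (p ^ suc j *_) (divisors m)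
  divisors-m*p^[1+j] {x} x∈ with ∈-divisors⁻ x∈
  ... | x≥1 , x∣ with x ∣? m * p ^ j
  ...   | yes x∣′ = ∈-++⁺ˡ (∈-divisors⁺ m*p^j≥1 x∣′)
  ...   | no x∤ with new-divisor j p-prime p∤m x≥1 x∣ x∤
  ...     | u , refl , u∣m = ∈-++⁺ʳ _ (∈-map⁺ (c *_) (∈-divisors⁺ m≥1 u∣m))

  module _ {D₁ D₂ : List ℕ} (D₁⊆ : D₁ ⊆ₛ divisors (m * p ^ j)) (D₂⊆ : D₂ ⊆ₛ divisors m) where

    combined-! : Unique D₁ → Unique D₂ → Unique (D₁ ++ map (p ^ suc j *_) D₂)
    combined-! D₁! D₂! = Unique.++⁺ D₁! (Unique.map⁺ (*-cancelˡ-≡ _ _ c {{>-nonZero c≥1}}) D₂!) disjoint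
      where
      disjoint : ∀ {v} → ¬ (v ∈ D₁ × v ∈ map (c *_) D₂)
      disjoint (v∈D₁ , v∈cD₂) with ∈-map⁻ (c *_) v∈cD₂
      ... | _ , _ , refl = p^[1+k]∤m*p^k j p-prime p∤m
        (∣-trans (m∣m*n _) (proj₂ (∈-divisors⁻ (D₁⊆ v∈D₁))))

    combined-⊆ : D₁ ++ map (p ^ suc j *_) D₂ ⊆ₛ divisors (m * p ^ suc j)
    combined-⊆ {x} x∈ with ∈-++⁻ D₁ x∈
    ... | inj₁ x∈D₁ = divisors-mono m*c≥1 (*-monoʳ-∣ m (n∣m*n p)) (D₁⊆ x∈D₁)
    ... | inj₂ x∈cD₂ with ∈-map⁻ (c *_) x∈cD₂
    ...   | u , u∈D₂ , refl = ∈-divisors⁺ m*c≥1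
      (subst (c * u ∣_) (*-comm c m) (*-monoʳ-∣ c (proj₂ (∈-divisors⁻ (D₂⊆ u∈D₂)))))

    sum-combined :
      sum (map f (D₁ ++ map (p ^ suc j *_) D₂)) ≡ sum (map f D₁) + f (p ^ suc j) * sum (map f D₂)
    sum-combined = trans (sum-map-++ f D₁ _) (cong (sum (map f D₁) +_) (sum-map-c* D₂⊆))
      where
      open ≡-Reasoning
      sum-map-c* : ∀ {D} → D ⊆ₛ divisors m → sum (map f (map (c *_) D)) ≡ f c * sum (map f D)
      sum-map-c* {[]} _ = sym (*-zeroʳ (f c))
      sum-map-c* {u ∷ D} D⊆ = begin
        f (c * u) + sum (map f (map (c *_) D)) ≡⟨ cong₂ _+_ f[c*u] (sum-map-c* (D⊆ ∘ there)) ⟩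
        f c * f u + f c * sum (map f D)        ≡⟨ *-distribˡ-+ (f c) (f u) _ ⟨
        f c * (f u + sum (map f D))            ∎
        where
        u≥1 : 1 ≤ u
        u≥1 = proj₁ (∈-divisors⁻ {n = m} (D⊆ (here refl)))
        p∤u : ¬ p ∣ u
        p∤u p∣u = p∤m (∣-trans p∣u (proj₂ (∈-divisors⁻ {n = m} (D⊆ (here refl)))))
        f[c*u] : f (c * u) ≡ f c * f u
        f[c*u] = f-^* f mult (suc j) p-prime p∤u u≥1

  S-m*p^[1+j]≤ : S f (m * p ^ suc j) ≤ S f (m * p ^ j) + f (p ^ suc j) * S f m
  S-m*p^[1+j]≤ = ≤-trans
    (sum-map-mono-⊆ₛ _≟_ f (divisors-! (m * p ^ suc j))
      (combined-! ⊆ₛ-refl ⊆ₛ-refl (divisors-! (m * p ^ j)) (divisors-! m)) divisors-m*p^[1+j])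
    (≤-reflexive (sum-combined ⊆ₛ-refl ⊆ₛ-refl))

  -- Stewart's argument: write N = r + f(p^(j+1)) t with r, t representable over m p^j and m.
  practical-step : Practical f m → Practical f (m * p ^ j) → f (p ^ suc j) ≤ S f (m * p ^ j) + 1 →
    Practical f (m * p ^ suc j)
  practical-step m-prac m*p^j-prac f[c]≤ = m*c≥1 , represent
    where
    represent : ∀ N → 1 ≤ N → N ≤ S f (m * p ^ suc j) → Representable f (m * p ^ suc j) N
    represent N _ N≤ with bounded-decomposition (S f m) f[c]≤ (≤-trans N≤ S-m*p^[1+j]≤)
    ... | t , r , t≤ , r≤ , N≡
      with practical⇒representable f m*p^j-prac r≤ | practical⇒representable f m-prac t≤
    ... | D₁ , D₁⊆ , ΣD₁≡r | D₂ , D₂⊆ , ΣD₂≡t =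
      subst (Representable f (m * p ^ suc j)) ΣD≡N
        (distinct-divisors⇒representable f {n = m * p ^ suc j} D! (combined-⊆ D₁⊆ₛ D₂⊆ₛ))
      where
      open ≡-Reasoning
      D₁⊆ₛ = sublist⇒subset D₁⊆
      D₂⊆ₛ = sublist⇒subset D₂⊆
      D! : Unique (D₁ ++ map (c *_) D₂)
      D! = combined-! D₁⊆ₛ D₂⊆ₛ
        (Unique-resp-⊆ D₁⊆ (divisors-! (m * p ^ j))) (Unique-resp-⊆ D₂⊆ (divisors-! m))
      ΣD≡N : sum (map f (D₁ ++ map (c *_) D₂)) ≡ N
      ΣD≡N = begin
        sum (map f (D₁ ++ map (c *_) D₂))     ≡⟨ sum-combined D₁⊆ₛ D₂⊆ₛ ⟩
        sum (map f D₁) + f c * sum (map f D₂) ≡⟨ cong₂ (λ x y → x + f c * y) ΣD₁≡r ΣD₂≡t ⟩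
        r + f c * t                           ≡⟨ N≡ ⟨
        N                                     ∎

-- Prime-power factorisations sorted by f

PrimePowers : List (ℕ × ℕ) → Set
PrimePowers = All (λ pe → Prime (proj₁ pe) × 1 ≤ proj₂ pe)

DistinctPrimes : List (ℕ × ℕ) → Set
DistinctPrimes = AllPairs (λ a b → proj₁ a ≢ proj₁ b)

SortedBy : (ℕ → ℕ) → List (ℕ × ℕ) → Set
SortedBy f = AllPairs (λ a b → f (proj₁ a) ≤ f (proj₁ b))

ppProduct≥1 : ∀ {L} → PrimePowers L → 1 ≤ ppProduct L
ppProduct≥1 [] = s≤s z≤n
ppProduct≥1 {(q , e) ∷ _} ((q-prime , _) ∷ L-pp) = *-mono-≤ (prime^≥1 q-prime e) (ppProduct≥1 L-pp)

primes∣ppProduct : ∀ {L} → PrimePowers L → All (λ pe → proj₁ pe ∣ ppProduct L) L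
primes∣ppProduct [] = []
primes∣ppProduct {(q , suc e) ∷ L} ((_ , _) ∷ L-pp) =
  ∣-trans (m∣m*n (q ^ e)) (m∣m*n _) ∷ All.map (∣n⇒∣m*n (q ^ suc e)) (primes∣ppProduct L-pp)

∤ppProduct⇒fresh : ∀ {q L} → PrimePowers L → ¬ q ∣ ppProduct L → All (λ pe → q ≢ proj₁ pe) L
∤ppProduct⇒fresh L-pp q∤ = All.map (λ r∣ q≡r → q∤ (subst (_∣ _) (sym q≡r) r∣)) (primes∣ppProduct L-pp)

∣ppProduct⇒prime∣ : ∀ {a d} L → PrimePowers L → d ∣ a * ppProduct L → ¬ d ∣ a →
  Any (λ pe → proj₁ pe ∣ d) L
∣ppProduct⇒prime∣ {a} {d} [] [] d∣ d∤a = ⊥-elim (d∤a (subst (d ∣_) (*-identityʳ a) d∣))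
∣ppProduct⇒prime∣ {a} {d} ((r , e) ∷ L) ((r-prime , _) ∷ L-pp) d∣ d∤a with r ∣? d
... | yes r∣d = here r∣d
... | no r∤d = there (∣ppProduct⇒prime∣ L L-pp d∣a*L d∤a)
  where
  d∣a*L : d ∣ a * ppProduct L
  d∣a*L = coprime-divisor (Coprime.sym (coprime-^ˡ e (prime∤⇒coprime r-prime r∤d)))
    (subst (d ∣_) (x∙yz≈y∙xz a (r ^ e) _) d∣)

module SortByPrimeValue (f : ℕ → ℕ) where

  insert : ℕ × ℕ → List (ℕ × ℕ) → List (ℕ × ℕ)
  insert x [] = x ∷ []
  insert x (y ∷ L) with f (proj₁ x) ℕ.≤? f (proj₁ y)
  ... | yes _ = x ∷ y ∷ L
  ... | no _ = y ∷ insert x L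

  insert-All : ∀ {P : ℕ × ℕ → Set} {x} L → P x → All P L → All P (insert x L)
  insert-All [] px [] = px ∷ []
  insert-All {x = x} (y ∷ L) px (py ∷ pL) with f (proj₁ x) ℕ.≤? f (proj₁ y)
  ... | yes _ = px ∷ py ∷ pL
  ... | no _ = py ∷ insert-All L px pL

  insert-distinct : ∀ x L → All (λ b → proj₁ x ≢ proj₁ b) L → DistinctPrimes L →
    DistinctPrimes (insert x L)
  insert-distinct x [] [] [] = [] ∷ []
  insert-distinct x (y ∷ L) (x≢y ∷ x≢L) (y≢L ∷ L-distinct) with f (proj₁ x) ℕ.≤? f (proj₁ y)
  ... | yes _ = (x≢y ∷ x≢L) ∷ y≢L ∷ L-distinct
  ... | no _ = insert-All L (x≢y ∘ sym) y≢L ∷ insert-distinct x L x≢L L-distinct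

  insert-sorted : ∀ x L → SortedBy f L → SortedBy f (insert x L)
  insert-sorted x [] [] = [] ∷ []
  insert-sorted x (y ∷ L) (y≤L ∷ L-sorted) with f (proj₁ x) ℕ.≤? f (proj₁ y)
  ... | yes x≤y = (x≤y ∷ All.map (≤-trans x≤y) y≤L) ∷ y≤L ∷ L-sorted
  ... | no x≰y = insert-All L (<⇒≤ (≰⇒> x≰y)) y≤L ∷ insert-sorted x L L-sorted

  ppProduct-insert : ∀ q e L → ppProduct (insert (q , e) L) ≡ q ^ e * ppProduct L
  ppProduct-insert q e [] = refl
  ppProduct-insert q e ((r , e′) ∷ L) with f q ℕ.≤? f r
  ... | yes _ = refl
  ... | no _ = trans (cong (r ^ e′ *_) (ppProduct-insert q e L)) (x∙yz≈y∙xz (r ^ e′) (q ^ e) _)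

  prime-divisor : ∀ m → 1 < m → ∃ λ q → Prime q × q ∣ m
  prime-divisor m m>1 with factorise m {{>-nonZero (<-trans (s≤s z≤n) m>1)}}
  ... | record { factors = [] ; isFactorisation = m≡1 } = ⊥-elim (<⇒≢ m>1 (sym m≡1))
  ... | record { factors = q ∷ _ ; isFactorisation = m≡ ; factorsPrime = q-prime ∷ _ } =
    q , q-prime , subst (q ∣_) (sym m≡) (m∣m*n _)

  SortedFactorisation : ℕ → Set
  SortedFactorisation m = ∃ λ L → PrimePowers L × DistinctPrimes L × SortedBy f L × ppProduct L ≡ m

  sorted-factorisation : ∀ m → 1 ≤ m → SortedFactorisation m
  sorted-factorisation = <-rec _ factor
    where
    factor : ∀ m → (∀ {u} → u < m → 1 ≤ u → SortedFactorisation u) → 1 ≤ m → SortedFactorisation m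
    factor (suc zero) _ _ = [] , [] , [] , [] , refl
    factor m@(suc (suc _)) rec m≥1 with prime-divisor m (s≤s (s≤s z≤n))
    ... | q , q-prime , q∣m with p-adic-split q-prime m m≥1
    ...   | zero , u , m≡u , q∤u = ⊥-elim (q∤u (subst (q ∣_) (trans m≡u (*-identityˡ u)) q∣m))
    ...   | suc a , u , m≡ , q∤u with rec u<m u≥1
      where
      u≥1 = *-pos⇒posʳ (q ^ suc a) (subst (1 ≤_) m≡ m≥1)
      u<m : u < m
      u<m = subst (u <_) (trans (*-comm u _) (sym m≡))
        (m<m*n u (q ^ suc a) {{>-nonZero u≥1}} (prime^>1 {k = suc a} q-prime (s≤s z≤n)))
    ...     | L , L-pp , L-distinct , L-sorted , L≡u =
      insert (q , suc a) L ,
      insert-All L (q-prime , s≤s z≤n) L-pp ,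
      insert-distinct (q , suc a) L (∤ppProduct⇒fresh L-pp (subst (λ n → ¬ q ∣ n) (sym L≡u) q∤u))
        L-distinct ,
      insert-sorted (q , suc a) L L-sorted ,
      trans (ppProduct-insert q (suc a) L) (trans (cong (q ^ suc a *_) L≡u) (sym m≡))

  weakCond-mono : ∀ {a b} L → PrimePowers L → 1 ≤ b → a ∣ b → WeakCond f a L → WeakCond f b L
  weakCond-mono [] _ _ _ _ = tt
  weakCond-mono ((q , e) ∷ L) ((q-prime , _) ∷ L-pp) b≥1 a∣b (f[q]≤ , weak) =
    ≤-trans f[q]≤ (+-monoˡ-≤ 1 (S-mono f b≥1 a∣b)) ,
    weakCond-mono L L-pp (*-mono-≤ b≥1 (prime^≥1 q-prime e)) (*-monoˡ-∣ (q ^ e) a∣b) weak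

  -- The condition at an inserted p follows from that at the next prime q, as f(p) ≤ f(q);
  -- the later ones only weaken, S_f being monotone under divisibility.
  weakCond-insert : ∀ {a} x L → PrimePowers (x ∷ L) → 1 ≤ a → WeakCond f a L →
    f (proj₁ x) ≤ S f (a * ppProduct L) + 1 → WeakCond f a (insert x L)
  weakCond-insert {a} x [] _ _ _ f[x]≤ = subst (λ n → f (proj₁ x) ≤ S f n + 1) (*-identityʳ a) f[x]≤ , tt
  weakCond-insert {a} x@(p , e) ((q , e′) ∷ L) ((p-prime , e≥1) ∷ qL-pp@((q-prime , _) ∷ L-pp)) a≥1
    (f[q]≤ , weak) f[p]≤ with f p ℕ.≤? f q
  ... | yes f[p]≤f[q] = ≤-trans f[p]≤f[q] f[q]≤ ,
    weakCond-mono {a} ((q , e′) ∷ L) qL-pp (*-mono-≤ a≥1 (prime^≥1 p-prime e)) (m∣m*n _) (f[q]≤ , weak)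
  ... | no _ = f[q]≤ , weakCond-insert {a * q ^ e′} x L ((p-prime , e≥1) ∷ L-pp)
    (*-mono-≤ a≥1 (prime^≥1 q-prime e′)) weak
    (subst (λ n → f p ≤ S f n + 1) (sym (*-assoc a _ _)) f[p]≤)

open SortByPrimeValue

-- The condition implies convenience

module _ (f : ℕ → ℕ) (mult : Multiplicative f)
  (extends : ∀ p m → Prime p → Practical f m → Coprime m p → f p ≤ S f m + 1
    → ∀ k → f (p ^ (k + 1)) ≤ S f (m * p ^ k) + 1) where

  practical-*-prime^ : ∀ {p m} → Prime p → Practical f m → Coprime m p → f p ≤ S f m + 1 →
    ∀ j → Practical f (m * p ^ j)
  practical-*-prime^ {p} {m} _ m-prac _ _ zero = subst (Practical f) (sym (*-identityʳ m)) m-prac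
  practical-*-prime^ {p} {m} p-prime m-prac m⊥p f[p]≤ (suc j) =
    practical-step f mult p-prime (coprime⇒∤ p-prime m⊥p) (proj₁ m-prac) j m-prac
      (practical-*-prime^ p-prime m-prac m⊥p f[p]≤ j)
      (subst (λ e → f (p ^ e) ≤ S f (m * p ^ j) + 1) (+-comm j 1)
        (extends p m p-prime m-prac m⊥p f[p]≤ j))

  practical-*-ppProduct : ∀ {a} L → Practical f a → PrimePowers L → DistinctPrimes L →
    All (λ pe → Coprime a (proj₁ pe)) L → WeakCond f a L → Practical f (a * ppProduct L)
  practical-*-ppProduct {a} [] a-prac _ _ _ _ = subst (Practical f) (sym (*-identityʳ a)) a-prac
  practical-*-ppProduct {a} ((p , e) ∷ L) a-prac ((p-prime , _) ∷ L-pp) (p≢L ∷ L-distinct) (a⊥p ∷ a⊥L)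
    (f[p]≤ , weak) =
    subst (Practical f) (*-assoc a (p ^ e) _)
      (practical-*-ppProduct L (practical-*-prime^ p-prime a-prac a⊥p f[p]≤ e) L-pp L-distinct
        (All.zipWith a*p^e⊥ (a⊥L , All.zip (L-pp , p≢L))) weak)
    where
    a*p^e⊥ : ∀ {qe} → Coprime a (proj₁ qe) × (Prime (proj₁ qe) × 1 ≤ proj₂ qe) × p ≢ proj₁ qe →
      Coprime (a * p ^ e) (proj₁ qe)
    a*p^e⊥ (a⊥q , (q-prime , _) , p≢q) =
      coprime-*ˡ a⊥q (coprime-^ˡ e (distinct-primes⇒coprime p-prime q-prime p≢q))

  extends⇒convenient : Convenient f
  extends⇒convenient n (L , L-pp , L-distinct , _ , L≡n , weak) =
    subst (Practical f) (trans (*-identityˡ _) L≡n)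
      (practical-*-ppProduct L (practical-1 f (proj₁ mult)) L-pp L-distinct
        (All.universal (1-coprimeTo ∘ proj₁) L) weak)

-- Convenience implies the condition

module _ (f : ℕ → ℕ) (f-pos : ∀ n → 1 ≤ n → 1 ≤ f n) where

  -- S_f(a) + 1 ≤ S_f(n) must be represented using some divisor of n outside a.
  practical⇒≤S+1 : ∀ {n a X} → Practical f n → 1 ≤ a → a ∣ n → a < n →
    (∀ d → 1 ≤ d → d ∣ n → ¬ d ∣ a → X ≤ f d) → X ≤ S f a + 1
  practical⇒≤S+1 {n} {a} {X} n-prac a≥1 a∣n a<n bound with practical⇒representable f n-prac S[a]+1≤S[n]
    where
    n≥1 = proj₁ n-prac
    n∉divisors[a] : All (n ≢_) (divisors a)
    n∉divisors[a] = All.tabulate λ d∈ n≡d →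
      <⇒≱ a<n (subst (_≤ a) (sym n≡d) (∣⇒≤ {{>-nonZero a≥1}} (proj₂ (∈-divisors⁻ d∈))))
    n∷divisors[a]⊆ : (n ∷ divisors a) ⊆ₛ divisors n
    n∷divisors[a]⊆ (here refl) = ∈-divisors⁺ n≥1 ∣-refl
    n∷divisors[a]⊆ (there d∈) = divisors-mono n≥1 a∣n d∈
    S[a]+1≤S[n] : S f a + 1 ≤ S f n
    S[a]+1≤S[n] = ≤-trans (≤-reflexive (+-comm (S f a) 1))
      (≤-trans (+-monoˡ-≤ (S f a) (f-pos n n≥1))
        (sum-map-mono-⊆ₛ _≟_ f (n∉divisors[a] ∷ divisors-! a) (divisors-! n) n∷divisors[a]⊆))
  ... | D , D⊆ , ΣD≡ with All.all? (_∣? a) D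
  ...   | yes D∣a = ⊥-elim (<⇒≱ (≤-reflexive (trans (+-comm 1 (S f a)) (sym ΣD≡)))
    (sum-map-mono-⊆ₛ _≟_ f (Unique-resp-⊆ D⊆ (divisors-! n)) (divisors-! a)
      (λ d∈D → ∈-divisors⁺ a≥1 (All.lookup D∣a d∈D))))
  ...   | no D∤a with find (¬All⇒Any¬ (_∣? a) D D∤a)
  ...     | d , d∈D , d∤a with ∈-divisors⁻ (sublist⇒subset D⊆ d∈D)
  ...       | d≥1 , d∣n = ≤-trans (bound d d≥1 d∣n d∤a) (≤-trans (∈⇒≤-sum-map f d∈D) (≤-reflexive ΣD≡))

  module _ (mult : Multiplicative f) (mono : ∀ p k → Prime p → 1 ≤ k → f (p ^ (k ∸ 1)) ≤ f (p ^ k)) where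

    practical⇒weakCond : ∀ {m} → Practical f m → ∀ {a} L → 1 ≤ a → a * ppProduct L ≡ m →
      PrimePowers L → SortedBy f L → WeakCond f a L
    practical⇒weakCond _ [] _ _ _ _ = tt
    practical⇒weakCond {m} m-prac {a} ((q , e) ∷ L) a≥1 a*qL≡m qL-pp@((q-prime , e≥1) ∷ L-pp)
      (f[q]≤L ∷ L-sorted) =
      practical⇒≤S+1 m-prac a≥1 (subst (a ∣_) a*qL≡m (m∣m*n _)) a<m bound ,
      practical⇒weakCond m-prac L (*-mono-≤ a≥1 (prime^≥1 q-prime e)) (trans (*-assoc a _ _) a*qL≡m)
        L-pp L-sorted
      where
      a<m : a < m
      a<m = subst (a <_) a*qL≡m
        (m<m*n a _ {{>-nonZero a≥1}} (*-mono-≤ (prime^>1 {k = e} q-prime e≥1) (ppProduct≥1 L-pp)))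
      bound : ∀ d → 1 ≤ d → d ∣ m → ¬ d ∣ a → f q ≤ f d
      bound d d≥1 d∣m d∤a with All.lookupAny (All.zip (≤-refl ∷ f[q]≤L , qL-pp))
        (∣ppProduct⇒prime∣ ((q , e) ∷ L) qL-pp (subst (d ∣_) (sym a*qL≡m) d∣m) d∤a)
      ... | (f[q]≤f[r] , r-prime , _) , r∣d =
        ≤-trans f[q]≤f[r] (f-prime≤f-multiple f mult f-pos mono r-prime r∣d d≥1)

    weaklyPractical-*-prime^ : ∀ {p m e} → Practical f m → Prime p → ¬ p ∣ m → f p ≤ S f m + 1 →
      1 ≤ e → WeaklyPractical f (m * p ^ e)
    weaklyPractical-*-prime^ {p} {m} {e} m-prac p-prime p∤m f[p]≤ e≥1
      with sorted-factorisation f m (proj₁ m-prac)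
    ... | L , L-pp , L-distinct , L-sorted , L≡m =
      insert f (p , e) L ,
      insert-All f L (p-prime , e≥1) L-pp ,
      insert-distinct f (p , e) L (∤ppProduct⇒fresh L-pp (subst (λ n → ¬ p ∣ n) (sym L≡m) p∤m))
        L-distinct ,
      insert-sorted f (p , e) L L-sorted ,
      trans (ppProduct-insert f p e L) (trans (cong (p ^ e *_) L≡m) (*-comm _ m)) ,
      weakCond-insert f (p , e) L ((p-prime , e≥1) ∷ L-pp) (s≤s z≤n)
        (practical⇒weakCond m-prac L (s≤s z≤n) 1*L≡m L-pp L-sorted)
        (subst (λ n → f p ≤ S f n + 1) (sym 1*L≡m) f[p]≤)
      where
      1*L≡m : 1 * ppProduct L ≡ m
      1*L≡m = trans (*-identityˡ _) L≡m

    convenient⇒extends : Convenient f → ∀ p m → Prime p → Practical f m → Coprime m p → f p ≤ S f m + 1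
      → ∀ k → f (p ^ (k + 1)) ≤ S f (m * p ^ k) + 1
    convenient⇒extends convenient p m p-prime m-prac m⊥p f[p]≤ k =
      subst (λ e → f (p ^ e) ≤ S f (m * p ^ k) + 1) (+-comm 1 k)
        (practical⇒≤S+1 m*p^[1+k]-prac (*-mono-≤ m≥1 (prime^≥1 p-prime k)) (*-monoʳ-∣ m (n∣m*n p))
          (*-monoʳ-< m {{>-nonZero m≥1}} (^-monoʳ-< p (prime>1 p-prime) {k} (n<1+n k))) bound)
      where
      p∤m = coprime⇒∤ p-prime m⊥p
      m≥1 = proj₁ m-prac
      m*p^[1+k]-prac : Practical f (m * p ^ suc k)
      m*p^[1+k]-prac =
        convenient _ (weaklyPractical-*-prime^ {e = suc k} m-prac p-prime p∤m f[p]≤ (s≤s z≤n))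
      bound : ∀ d → 1 ≤ d → d ∣ m * p ^ suc k → ¬ d ∣ m * p ^ k → f (p ^ suc k) ≤ f d
      bound d d≥1 d∣ d∤ with new-divisor k p-prime p∤m d≥1 d∣ d∤
      ... | u , refl , u∣m = f-^≤f-^* f mult f-pos (suc k) p-prime (λ p∣u → p∤m (∣-trans p∣u u∣m))
        (*-pos⇒posʳ (p ^ suc k) d≥1)

theorem3p3 : (f : ℕ → ℕ) → (∀ n → 1 ≤ n → 1 ≤ f n) → Multiplicative f
    → (∀ p k → Prime p → 1 ≤ k → f (p ^ (k ∸ 1)) ≤ f (p ^ k))
    → Convenient f ⇔
    (∀ p m → Prime p → Practical f m → Coprime m p → f p ≤ S f m + 1
    → ∀ k → f (p ^ (k + 1)) ≤ S f (m * p ^ k) + 1)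
theorem3p3 f f-pos mult mono = mk⇔ (convenient⇒extends f f-pos mult mono) (extends⇒convenient f mult)
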